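{- Let $n\ge 3$ and let $\mathbb{W}_{n}$ be the Web graph. If $M$ is any mixed metric generator of $\mathbb{W}_{n}$, then $\{r_i : 1\le i\le n\}\subseteq M$.
   Context: For an integer $n\ge 3$, the Web graph $\mathbb{W}_{n}$ has vertex set $\{p_i,q_i,r_i : 1\le i\le n\}$ ($3n$ vertices) and edge set $\{p_iq_i,\ p_ip_{i+1},\ q_iq_{i+1},\ q_ir_i : 1\le i\le n\}$ ($4n$ edges), with indices taken modulo $n$. For a connected graph $H$, $d_H(u,v)$ is the shortest-path distance, and for a vertex $x$ and an edge $e=uv$, $d_H(x,e)=\min\{d_H(x,u),d_H(x,v)\}$. A set $M\subseteq V(H)$ is a mixed metric generator of $H$ if for every two distinct elements $y_1,y_2\in V(H)\cup E(H)$ there is a vertex $z\in M$ with $d_H(z,y_1)\ne d_H(z,y_2)$. -}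

module Defs where

open import Data.Nat using (ℕ; zero; suc; _≤_; _⊔_; _⊓_)
open import Data.Nat.DivMod using (_%_; m%n<n)
open import Data.Fin using (Fin; toℕ; fromℕ<)
open import Data.Product using (_×_; _,_; ∃-syntax; Σ-syntax)
open import Data.Sum using (_⊎_)
open import Relation.Binary.PropositionalEquality using (_≡_)
open import Relation.Nullary using (¬_)
open import Data.Sum using (inj₁; inj₂)
open import Data.Product using (proj₁; proj₂)

next : ∀ {n} → Fin n → Fin n
next {suc m} i = fromℕ< (m%n<n (suc (toℕ i)) (suc m))

data Vtx (n : ℕ) : Set where
  p q r : Fin n → Vtx n

data Edg (n : ℕ) : Set where
  pq  : Fin n → Edg n
  pp  : Fin n → Edg n
  qq  : Fin n → Edg n
  qr  : Fin n → Edg n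

ends : ∀ {n} → Edg n → Vtx n × Vtx n
ends (pq i) = p i , q i
ends (pp i) = p i , p (next i)
ends (qq i) = q i , q (next i)
ends (qr i) = q i , r i

Adj : ∀ {n} → Vtx n → Vtx n → Set
Adj {n} u v = ∃[ e ] (ends {n} e ≡ (u , v) ⊎ ends e ≡ (v , u))

data Walk {n : ℕ} : Vtx n → Vtx n → ℕ → Set where
  here : ∀ {u} → Walk u u zero
  step : ∀ {u w v k} → Adj u w → Walk w v k → Walk u v (suc k)

Dist : ∀ {n} → Vtx n → Vtx n → ℕ → Set
Dist u v k = Walk u v k × (∀ m → Walk u v m → k ≤ m)

Elem : ℕ → Set
Elem n = Vtx n ⊎ Edg n

DistE : ∀ {n} → Vtx n → Elem n → ℕ → Set
DistE x (inj₁ v) k = Dist x v k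
DistE {n} x (inj₂ e) k =
  Σ[ a ∈ ℕ ] Σ[ b ∈ ℕ ] (Dist x (proj₁ (ends {n} e)) a
                         × Dist x (proj₂ (ends e)) b × k ≡ a ⊓ b)

MixedMetricGenerator : ∀ {n} → (Vtx n → Set) → Set
MixedMetricGenerator {n} M =
  ∀ (y₁ y₂ : Elem n) → ¬ (y₁ ≡ y₂) →
    ∃[ z ] (M z × (∀ k₁ k₂ → DistE z y₁ k₁ → DistE z y₂ k₂ → ¬ (k₁ ≡ k₂)))

{-# OPTIONS --safe #-}
-- Every vertex z ≠ rᵢ reaches rᵢ only through its unique neighbour qᵢ, so
-- d(z, qᵢ) ≤ d(z, rᵢ) and hence d(z, qᵢrᵢ) = d(z, qᵢ): the vertex qᵢ and the
-- pendant edge qᵢrᵢ are told apart by rᵢ alone, which must therefore lie in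
-- every mixed metric generator.
module Submission where

open import Defs
open import Data.Nat using (ℕ; zero; suc; _≤_; _<_; _⊓_; _%_; z≤n; s≤s; _≤?_)
open import Data.Nat.Properties using (≤-trans; n≤1+n; ≰⇒>; m≤n⇒m⊓n≡m)
open import Data.Nat.DivMod using (m<n⇒m%n≡m)
open import Data.Nat.Induction using (<-rec)
open import Data.Fin using (Fin; toℕ; fromℕ<) renaming (zero to fzero)
open import Data.Fin.Properties using (toℕ-injective; toℕ-fromℕ<; fromℕ<-toℕ; toℕ<n)
  renaming (_≟_ to _≟ᶠ_)
open import Data.Product using (∃; _×_; _,_; proj₁; proj₂)
open import Data.Sum using (_⊎_; inj₁; inj₂)
open import Relation.Nullary using (¬_; yes; no)
open import Relation.Nullary.Negation using (contradiction)
open import Relation.Binary.PropositionalEquality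
  using (_≡_; _≢_; refl; sym; cong; subst; module ≡-Reasoning)

Reachable : ∀ {n} → Vtx n → Vtx n → Set
Reachable u v = ∃ (Walk u v)

Adj-sym : ∀ {n} {u v : Vtx n} → Adj u v → Adj v u
Adj-sym (e , inj₁ uv) = e , inj₂ uv
Adj-sym (e , inj₂ vu) = e , inj₁ vu

Reachable-trans : ∀ {n} {u v w : Vtx n} → Reachable u v → Reachable v w → Reachable u w
Reachable-trans (_ , here) vw = vw
Reachable-trans (_ , step a xv) vw with Reachable-trans (_ , xv) vw
... | k , xw = suc k , step a xw

Reachable-sym : ∀ {n} {u v : Vtx n} → Reachable u v → Reachable v u
Reachable-sym (_ , here) = _ , here
Reachable-sym (_ , step a xv) = Reachable-trans (Reachable-sym (_ , xv)) (1 , step (Adj-sym a) here)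

ends-Reachable : ∀ {n} (e : Edg n) → Reachable (proj₁ (ends e)) (proj₂ (ends e))
ends-Reachable e = 1 , step (e , inj₁ refl) here

next-fromℕ< : ∀ {k m} (k<n : k < suc m) (1+k<n : suc k < suc m) →
              next (fromℕ< k<n) ≡ fromℕ< 1+k<n
next-fromℕ< {k} {m} k<n 1+k<n = toℕ-injective (begin
  toℕ (next (fromℕ< k<n))        ≡⟨ toℕ-fromℕ< _ ⟩
  suc (toℕ (fromℕ< k<n)) % suc m  ≡⟨ cong (λ t → suc t % suc m) (toℕ-fromℕ< k<n) ⟩
  suc k % suc m                   ≡⟨ m<n⇒m%n≡m 1+k<n ⟩
  suc k                           ≡⟨ sym (toℕ-fromℕ< 1+k<n) ⟩
  toℕ (fromℕ< 1+k<n)              ∎)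
  where open ≡-Reasoning

q₀-Reachable-q : ∀ {m} k (k<n : k < suc m) → Reachable (q fzero) (q (fromℕ< k<n))
q₀-Reachable-q zero    _     = 0 , here
q₀-Reachable-q {m} (suc k) 1+k<n = Reachable-trans (q₀-Reachable-q k k<n)
  (subst (λ j → Reachable (q (fromℕ< k<n)) (q j)) (next-fromℕ< k<n 1+k<n)
         (ends-Reachable (qq (fromℕ< k<n))))
  where
  k<n : k < suc m
  k<n = ≤-trans (n≤1+n (suc k)) 1+k<n

q-Reachable-q₀ : ∀ {m} (j : Fin (suc m)) → Reachable (q j) (q fzero)
q-Reachable-q₀ j = Reachable-sym
  (subst (λ i → Reachable (q fzero) (q i)) (fromℕ<-toℕ j (toℕ<n j)) (q₀-Reachable-q _ (toℕ<n j)))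

Reachable-q₀ : ∀ {m} (u : Vtx (suc m)) → Reachable u (q fzero)
Reachable-q₀ (p j) = Reachable-trans (ends-Reachable (pq j)) (q-Reachable-q₀ j)
Reachable-q₀ (q j) = q-Reachable-q₀ j
Reachable-q₀ (r j) = Reachable-trans (Reachable-sym (ends-Reachable (qr j))) (q-Reachable-q₀ j)

connected : ∀ {n} (u v : Vtx n) → Reachable u v
connected {suc _} u v = Reachable-trans (Reachable-q₀ u) (Reachable-sym (Reachable-q₀ v))
connected {zero} (p ()) _
connected {zero} (q ()) _
connected {zero} (r ()) _

-- A shortest walk exists only up to double negation, since `Walk u v m` is
-- not decided; this suffices because the conclusion it serves is ⊥.
Reachable⇒¬¬Dist : ∀ {n} {u v : Vtx n} → Reachable u v → ¬ ¬ ∃ (Dist u v)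
Reachable⇒¬¬Dist {u = u} {v} (k , w) =
  <-rec (λ k → Walk u v k → ¬ ¬ ∃ (Dist u v)) shortest k w
  where
  shortest : ∀ k → (∀ {j} → j < k → Walk u v j → ¬ ¬ ∃ (Dist u v)) →
             Walk u v k → ¬ ¬ ∃ (Dist u v)
  shortest k shorter w noDist = noDist (k , w , minimal)
    where
    minimal : ∀ m → Walk u v m → k ≤ m
    minimal m w′ with k ≤? m
    ... | yes k≤m = k≤m
    ... | no  k≰m = contradiction noDist (shorter (≰⇒> k≰m) w′)

Adj-r⇒≡q : ∀ {n} {u : Vtx n} {i} → Adj u (r i) → u ≡ q i
Adj-r⇒≡q (qr _ , inj₁ refl) = refl
Adj-r⇒≡q (pq _ , inj₁ ())
Adj-r⇒≡q (pp _ , inj₁ ())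
Adj-r⇒≡q (qq _ , inj₁ ())
Adj-r⇒≡q (pq _ , inj₂ ())
Adj-r⇒≡q (pp _ , inj₂ ())
Adj-r⇒≡q (qq _ , inj₂ ())
Adj-r⇒≡q (qr _ , inj₂ ())

Walk-r⇒Walk-q : ∀ {n} {u : Vtx n} {i k} → Walk u (r i) k →
                u ≡ r i ⊎ ∃ λ m → m ≤ k × Walk u (q i) m
Walk-r⇒Walk-q here = inj₁ refl
Walk-r⇒Walk-q (step a w) with Walk-r⇒Walk-q w
... | inj₁ refl          = inj₂ (0 , z≤n , subst (λ x → Walk x _ 0) (sym (Adj-r⇒≡q a)) here)
... | inj₂ (m , m≤k , w′) = inj₂ (suc m , s≤s m≤k , step a w′)

Dist-q≤Dist-r : ∀ {n} {u : Vtx n} {i a b} → u ≢ r i →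
                Dist u (q i) a → Dist u (r i) b → a ≤ b
Dist-q≤Dist-r u≢r (_ , a-min) (wb , _) with Walk-r⇒Walk-q wb
... | inj₁ u≡r            = contradiction u≡r u≢r
... | inj₂ (m , m≤b , wm) = ≤-trans (a-min m wm) m≤b

Distinguishes : ∀ {n} → Vtx n → Elem n → Elem n → Set
Distinguishes z y₁ y₂ = ∀ k₁ k₂ → DistE z y₁ k₁ → DistE z y₂ k₂ → k₁ ≢ k₂

¬Distinguishes-q-qr : ∀ {n} {z : Vtx n} {i} → z ≢ r i →
                      ¬ Distinguishes z (inj₁ (q i)) (inj₂ (qr i))
¬Distinguishes-q-qr {z = z} {i} z≢r dis =
  Reachable⇒¬¬Dist (connected z (q i)) λ { (a , da) →
  Reachable⇒¬¬Dist (connected z (r i)) λ { (b , db) →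
  dis a (a ⊓ b) da (a , b , da , db , refl) (sym (m≤n⇒m⊓n≡m (Dist-q≤Dist-r z≢r da db))) } }

Distinguishes-q-qr⇒≡r : ∀ {n} (z : Vtx n) {i} →
                        Distinguishes z (inj₁ (q i)) (inj₂ (qr i)) → z ≡ r i
Distinguishes-q-qr⇒≡r (p _) dis = contradiction dis (¬Distinguishes-q-qr λ ())
Distinguishes-q-qr⇒≡r (q _) dis = contradiction dis (¬Distinguishes-q-qr λ ())
Distinguishes-q-qr⇒≡r (r j) {i} dis with j ≟ᶠ i
... | yes refl = refl
... | no  j≢i  = contradiction dis (¬Distinguishes-q-qr λ { refl → j≢i refl })

lemma4 : (n : ℕ) → 3 ≤ n → (M : Vtx n → Set) → MixedMetricGenerator M →
         (i : Fin n) → M (r i)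
lemma4 n _ M generator i with generator (inj₁ (q i)) (inj₂ (qr i)) (λ ())
... | z , z∈M , dis = subst M (Distinguishes-q-qr⇒≡r z dis) z∈M
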